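{- Let $(\mathcal C,\mathcal S)$ be a conjunctive algebra with $\mathcal C=(\mathbb C,\otimes,(\ )^\perp,\mathbf 1,\preccurlyeq)$. Then for all $a,b,c\in\mathbb C$: $(a⅋b)\otimes c\multimap a⅋(b\otimes c)\in\mathcal S$.
   Context: A conjunctive structure $(\mathbb C,\otimes,(\ )^\perp,\preccurlyeq)$: $(\mathbb C,\bigvee,\preccurlyeq)$ complete join-semilattice (hence complete lattice with meets $\bigwedge$), $\otimes$ monotone, $(\ )^\perp$ antimonotone and involutive, $\otimes$ distributes over arbitrary joins on both sides, $(\bigvee\mathfrak B)^\perp=\bigwedge_{b\in\mathfrak B}b^\perp$. Define $a⅋b:=(a^\perp\otimes b^\perp)^\perp$ and $a\multimap b:=(a\otimes b^\perp)^\perp$. A conjunctive algebra adds a unit $\mathbf 1$ and a set $\mathcal S\subseteq\mathbb C$ containing $\mathbf 1$ and $S_3:=\bigwedge_{a,b}(a\otimes b\multimap b\otimes a)$, $S_4:=\bigwedge_{a,b,c}(a\multimap b)\multimap(b\multimap c)\multimap a\multimap c$, $S_5:=\bigwedge_{a,b,c}((a\otimes b)\otimes c)\multimap(a\otimes(b\otimes c))$, $S_6:=\bigwedge_a a\multimap(\mathbf 1\otimes a)$, $S_7:=\bigwedge_a(\mathbf 1\otimes a)\multimap a$, which is upward closed, closed under modus ponens, under $a\multimap b\in\mathcal S\Rightarrow a\otimes c\multimap b\otimes c\in\mathcal S$, and under $a\multimap b\in\mathcal S\Rightarrow b^\perp\multimap a^\perp\in\mathcal S$. -}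

module Defs where

open import Level using (Level; suc; _⊔_)
open import Data.Product using (Σ; ∃; _×_; _,_)
import Data.Product
open import Relation.Binary.PropositionalEquality using (_≡_)

record ConjunctiveStructure (ℓ : Level) : Set (suc ℓ) where
  infixr 8 _⊗_
  infix 4 _≼_
  field
    C    : Set ℓ
    _≼_  : C → C → Set ℓ
    ≼-refl    : ∀ {a} → a ≼ a
    ≼-trans   : ∀ {a b c} → a ≼ b → b ≼ c → a ≼ c
    ≼-antisym : ∀ {a b} → a ≼ b → b ≼ a → a ≡ b
    ⋁    : (C → Set ℓ) → C
    ⋁-ub    : ∀ (B : C → Set ℓ) {b} → B b → b ≼ ⋁ B
    ⋁-least : ∀ (B : C → Set ℓ) {u} → (∀ {b} → B b → b ≼ u) → ⋁ B ≼ u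
    _⊗_  : C → C → C
    _⊥   : C → C
    ⊗-mono  : ∀ {a a' b b'} → a ≼ a' → b ≼ b' → (a ⊗ b) ≼ (a' ⊗ b')
    ⊥-anti  : ∀ {a b} → a ≼ b → (b ⊥) ≼ (a ⊥)
    ⊥-invol : ∀ a → (a ⊥) ⊥ ≡ a

  ⋀ : (C → Set ℓ) → C
  ⋀ B = ⋁ (λ x → ∀ {b} → B b → x ≼ b)

  Img : {I : Set ℓ} → (I → C) → C → Set ℓ
  Img {I} f x = Σ I (λ i → f i ≡ x)

  ⋀ᶠ : {I : Set ℓ} → (I → C) → C
  ⋀ᶠ f = ⋀ (Img f)

  infixr 7 _⅋_
  infixr 5 _⊸_
  _⅋_ : C → C → C
  a ⅋ b = ((a ⊥) ⊗ (b ⊥)) ⊥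

  _⊸_ : C → C → C
  a ⊸ b = (a ⊗ (b ⊥)) ⊥

  field
    ⊗-distribˡ : ∀ a (B : C → Set ℓ) → a ⊗ ⋁ B ≡ ⋁ (Img (λ (p : Σ C B) → a ⊗ Data.Product.proj₁ p))
    ⊗-distribʳ : ∀ a (B : C → Set ℓ) → ⋁ B ⊗ a ≡ ⋁ (Img (λ (p : Σ C B) → Data.Product.proj₁ p ⊗ a))
    ⊥-⋁ : ∀ (B : C → Set ℓ) → (⋁ B) ⊥ ≡ ⋀ (Img (λ (p : Σ C B) → Data.Product.proj₁ p ⊥))

record ConjunctiveAlgebra (ℓ : Level) : Set (suc ℓ) where
  field
    structure : ConjunctiveStructure ℓ
  open ConjunctiveStructure structure public
  field
    𝟏 : C
    𝒮 : C → Set ℓ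

  S₃ : C
  S₃ = ⋀ᶠ (λ (p : C × C) → let (a , b) = p in (a ⊗ b) ⊸ (b ⊗ a))
  S₄ : C
  S₄ = ⋀ᶠ (λ (p : C × C × C) → let (a , b , c) = p in (a ⊸ b) ⊸ (b ⊸ c) ⊸ a ⊸ c)
  S₅ : C
  S₅ = ⋀ᶠ (λ (p : C × C × C) → let (a , b , c) = p in ((a ⊗ b) ⊗ c) ⊸ (a ⊗ (b ⊗ c)))
  S₆ : C
  S₆ = ⋀ᶠ (λ a → a ⊸ (𝟏 ⊗ a))
  S₇ : C
  S₇ = ⋀ᶠ (λ a → (𝟏 ⊗ a) ⊸ a)

  field
    𝟏∈𝒮  : 𝒮 𝟏
    S₃∈𝒮 : 𝒮 S₃
    S₄∈𝒮 : 𝒮 S₄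
    S₅∈𝒮 : 𝒮 S₅
    S₆∈𝒮 : 𝒮 S₆
    S₇∈𝒮 : 𝒮 S₇
    𝒮-upward : ∀ {a b} → 𝒮 a → a ≼ b → 𝒮 b
    𝒮-mp     : ∀ {a b} → 𝒮 (a ⊸ b) → 𝒮 a → 𝒮 b
    𝒮-⊗ʳ     : ∀ {a b c} → 𝒮 (a ⊸ b) → 𝒮 ((a ⊗ c) ⊸ (b ⊗ c))
    𝒮-contra : ∀ {a b} → 𝒮 (a ⊸ b) → 𝒮 ((b ⊥) ⊸ (a ⊥))

-- By definition a ⅋ x is a ⊥ ⊸ x.  The claim thus says
-- that (a ⊥ ⊸ b) ⊗ c entails a ⊥ ⊸ (b ⊗ c); by currying it suffices to move
-- a ⊥ next to a ⊥ ⊸ b with associativity and commutativity of ⊗ and then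
-- evaluate the implication.
{-# OPTIONS --safe #-}
module Submission where

open import Defs
open import Level using (Level)
open import Data.Product using (_,_)
open import Relation.Binary.PropositionalEquality using (refl; sym; subst)

module Entailment {ℓ : Level} (𝒜 : ConjunctiveAlgebra ℓ) where
  open ConjunctiveAlgebra 𝒜

  infix 3 _⊢_
  _⊢_ : C → C → Set ℓ
  x ⊢ y = 𝒮 (x ⊸ y)

  ⋀ᶠ-lowerBound : ∀ {I : Set ℓ} (f : I → C) (i : I) → ⋀ᶠ f ≼ f i
  ⋀ᶠ-lowerBound f i = ⋁-least _ (λ isLowerBound → isLowerBound (i , refl))

  ⊢-trans : ∀ {x y z} → x ⊢ y → y ⊢ z → x ⊢ z
  ⊢-trans {x} {y} {z} x⊢y y⊢z =
    𝒮-mp (𝒮-mp (𝒮-upward S₄∈𝒮 (⋀ᶠ-lowerBound _ (x , y , z))) x⊢y) y⊢z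

  ⊢-refl : ∀ {x} → x ⊢ x
  ⊢-refl {x} = ⊢-trans (𝒮-upward S₆∈𝒮 (⋀ᶠ-lowerBound _ x))
                       (𝒮-upward S₇∈𝒮 (⋀ᶠ-lowerBound _ x))

  ⊗-comm : ∀ {x y} → x ⊗ y ⊢ y ⊗ x
  ⊗-comm {x} {y} = 𝒮-upward S₃∈𝒮 (⋀ᶠ-lowerBound _ (x , y))

  ⊗-assoc : ∀ {x y z} → (x ⊗ y) ⊗ z ⊢ x ⊗ (y ⊗ z)
  ⊗-assoc {x} {y} {z} = 𝒮-upward S₅∈𝒮 (⋀ᶠ-lowerBound _ (x , y , z))

  ⊗-assoc⁻¹ : ∀ {x y z} → x ⊗ (y ⊗ z) ⊢ (x ⊗ y) ⊗ z
  ⊗-assoc⁻¹ = ⊢-trans ⊗-comm (⊢-trans ⊗-assoc (⊢-trans ⊗-comm (⊢-trans ⊗-assoc ⊗-comm)))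

  ⊗-monoˡ-⊢ : ∀ {x y w} → x ⊢ y → x ⊗ w ⊢ y ⊗ w
  ⊗-monoˡ-⊢ = 𝒮-⊗ʳ

  ⊗-monoʳ-⊢ : ∀ {x y w} → x ⊢ y → w ⊗ x ⊢ w ⊗ y
  ⊗-monoʳ-⊢ x⊢y = ⊢-trans ⊗-comm (⊢-trans (⊗-monoˡ-⊢ x⊢y) ⊗-comm)

  -- Contraposition turns x ⊗ y ⊗ z ⊥ into the required shape up to a double ⊥.
  ⊸-curry : ∀ {x y z} → x ⊗ y ⊢ z → x ⊢ y ⊸ z
  ⊸-curry {x} {y} {z} xy⊢z =
    subst (λ t → 𝒮 ((x ⊗ t) ⊥)) (sym (⊥-invol (y ⊗ (z ⊥))))
      (𝒮-mp (𝒮-contra (⊗-assoc⁻¹ {x} {y} {z ⊥})) xy⊢z)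

  ⊸-uncurry : ∀ {x y z} → x ⊢ y ⊸ z → x ⊗ y ⊢ z
  ⊸-uncurry {x} {y} {z} x⊢y⊸z =
    𝒮-mp (𝒮-contra (⊗-assoc {x} {y} {z ⊥}))
      (subst (λ t → 𝒮 ((x ⊗ t) ⊥)) (⊥-invol (y ⊗ (z ⊥))) x⊢y⊸z)

  ⊸-eval : ∀ {x y} → (x ⊸ y) ⊗ x ⊢ y
  ⊸-eval = ⊸-uncurry ⊢-refl

  ⊸-⊗-distribˡ : ∀ x y z → (x ⊸ y) ⊗ z ⊢ x ⊸ (y ⊗ z)
  ⊸-⊗-distribˡ x y z = ⊸-curry
    (⊢-trans ⊗-assoc
    (⊢-trans (⊗-monoʳ-⊢ ⊗-comm)
    (⊢-trans ⊗-assoc⁻¹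
             (⊗-monoˡ-⊢ ⊸-eval))))

proposition3p16 : ∀ {ℓ : Level} (𝒜 : ConjunctiveAlgebra ℓ) →
    let open ConjunctiveAlgebra 𝒜 in
    ∀ (a b c : C) → 𝒮 (((a ⅋ b) ⊗ c) ⊸ (a ⅋ (b ⊗ c)))
proposition3p16 𝒜 a b c = ⊸-⊗-distribˡ (a ⊥) b c
  where open ConjunctiveAlgebra 𝒜
        open Entailment 𝒜
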